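{- Let $G$ be a graph and $k\geq 1$ an integer. Let $K^{(1)},\dots,K^{(m)}$ be distinct maximal cliques of $G$, and for each $i$ let $n_i'$ be the number of simplicial vertices of $G$ lying in $K^{(i)}$, where $n_i'\geq 2$ for all $i$. Then $SSPC_{kU}(G)\geq \sum_{i=1}^{m}(n_i'-1)$.
   Context: All graphs are finite and simple; $d(u,v)$ is the distance. A vertex is simplicial if its neighbourhood induces a complete graph. A set $S\subseteq V(G)$ is a $k$-strong shortest path union cover of $G$ if one can choose, for each $u\in S$ and each $v\in V(G)$ with $d(u,v)\leq k$, a single shortest $u$–$v$ path $P(u,v)$ such that the union of the edge sets of all chosen paths equals $E(G)$; $SSPC_{kU}(G)$ is the minimum cardinality of such a set. -}

module Defs where

open import Data.Bool using (Bool; true; false; T)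
open import Data.Nat using (ℕ; suc; _≤_)
open import Data.Fin using (Fin; _≟_)
open import Data.Fin.Properties using (all?)
open import Data.Fin.Subset using (Subset; _∈_; _∉_; _⊆_; ∣_∣)
open import Data.Fin.Subset.Properties using (_∈?_)
open import Data.List using (List; []; _∷_; length)
open import Data.Vec using (tabulate)
open import Data.Product using (Σ; ∃; ∃-syntax; _×_; _,_)
open import Data.Sum using (_⊎_)
open import Relation.Binary.PropositionalEquality using (_≡_; _≢_)
open import Relation.Nullary using (Dec; yes; no; ¬_; does)
open import Relation.Nullary.Decidable using (_→-dec_; _×-dec_; ¬?)

record Graph (n : ℕ) : Set where
  field
    adj    : Fin n → Fin n → Bool
    sym    : ∀ a b → adj a b ≡ adj b a
    irrefl : ∀ a → adj a a ≡ false

module _ {n : ℕ} (G : Graph n) where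
  open Graph G

  Adj : Fin n → Fin n → Set
  Adj a b = T (adj a b)

  -- WalkL u v p : the vertex list p is a walk u = p₀, p₁, …, p_ℓ = v with consecutive vertices adjacent.
  -- Its length (number of edges) is  length p ∸ 1.
  data WalkL : Fin n → Fin n → List (Fin n) → Set where
    single : ∀ {u} → WalkL u u (u ∷ [])
    step   : ∀ {u w v p} → Adj u w → WalkL w v p → WalkL u v (u ∷ p)

  -- d(u,v) ≤ k : there is a u–v walk with at most k edges.
  DistLE : Fin n → Fin n → ℕ → Set
  DistLE u v k = ∃[ p ] (WalkL u v p × length p ≤ suc k)

  IsShortestPath : Fin n → Fin n → List (Fin n) → Set
  IsShortestPath u v p = WalkL u v p × (∀ q → WalkL u v q → length p ≤ length q)

  data Consec (a b : Fin n) : List (Fin n) → Set where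
    here  : ∀ {rest} → Consec a b (a ∷ b ∷ rest)
    there : ∀ {x rest} → Consec a b rest → Consec a b (x ∷ rest)

  EdgeOn : Fin n → Fin n → List (Fin n) → Set
  EdgeOn a b p = Consec a b p ⊎ Consec b a p

  -- S is a k-strong shortest path union cover: a choice of one shortest u–v path P(u,v)
  -- for each u ∈ S and v with d(u,v) ≤ k, whose edge sets cover E(G)
  -- (the other inclusion is automatic since paths only use edges of G).
  IsSSPCkU : ℕ → Subset n → Set
  IsSSPCkU k S =
    Σ (Fin n → Fin n → List (Fin n)) λ P →
      (∀ u v → u ∈ S → DistLE u v k → IsShortestPath u v (P u v)) ×
      (∀ a b → Adj a b → ∃[ u ] ∃[ v ] (u ∈ S × DistLE u v k × EdgeOn a b (P u v)))

  IsClique : Subset n → Set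
  IsClique K = ∀ a b → a ∈ K → b ∈ K → a ≢ b → Adj a b

  IsMaximalClique : Subset n → Set
  IsMaximalClique K = IsClique K × (∀ K′ → IsClique K′ → K ⊆ K′ → K′ ⊆ K)

  IsSimplicial : Fin n → Set
  IsSimplicial v = ∀ a b → Adj v a → Adj v b → a ≢ b → Adj a b

  adj? : ∀ a b → Dec (Adj a b)
  adj? a b with adj a b
  ... | true  = yes _
  ... | false = no (λ ())

  simplicial? : ∀ v → Dec (IsSimplicial v)
  simplicial? v = all? λ a → all? λ b →
    adj? v a →-dec (adj? v b →-dec (¬? (a ≟ b) →-dec adj? a b))

  simplicialIn : Subset n → Subset n
  simplicialIn K = tabulate (λ v → does ((v ∈? K) ×-dec simplicial? v))

  numSimplicialIn : Subset n → ℕ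
  numSimplicialIn K = ∣ simplicialIn K ∣

-- An interior vertex of a shortest path is never simplicial: its two neighbours on the path are
-- adjacent (or equal), giving a shortcut. So an edge between two simplicial vertices can only be
-- covered by a path starting at one of them, whence all but at most one of the simplicial vertices
-- of a clique lie in the cover S. A simplicial vertex lies in a unique maximal clique, so these
-- sets of simplicial vertices are pairwise disjoint and their contributions to ∣ S ∣ add up.
module Submission where

open import Defs
open import Data.Bool using (T; true; false; _∧_)
open import Data.Nat using (ℕ; zero; suc; _+_; _≤_; _<_; _∸_; s≤s; z≤n)
open import Data.Nat.Properties
  using (≤-refl; n≤1+n; +-mono-≤; +-monoʳ-≤; +-suc; <-irrefl; <-≤-trans; ∸-monoˡ-≤; module ≤-Reasoning)
open import Data.Nat.ListAction using (sum)
open import Data.Fin using (Fin; _≟_) renaming (zero to fzero; suc to fsuc)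
open import Data.Fin.Properties using (suc-injective; 0≢1+n)
open import Data.Fin.Subset using (Subset; ∣_∣; _∈_; _⊆_; _∩_; _∪_; ∁)
open import Data.Fin.Subset.Properties
  using (_∈?_; x∈p∩q⁺; x∈p∩q⁻; x∈p∪q⁺; x∈p∪q⁻; p⊆q⇒∣p∣≤∣q∣; ⊆-antisym; x∉p⇒x∈∁p; drop-there)
open import Data.Vec using ([]; _∷_; here; there)
open import Data.Vec.Properties using ([]=⇒lookup; lookup∘tabulate)
open import Data.List using (_∷_; length; tabulate)
open import Data.Product using (∃-syntax; _×_; _,_; proj₁)
open import Data.Sum using (_⊎_; inj₁; inj₂)
open import Data.Empty using (⊥-elim)
open import Function using (_∘_)
open import Relation.Nullary using (Dec; yes; no; does)
open import Relation.Binary.PropositionalEquality using (_≡_; _≢_; refl; sym; trans; subst; cong)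

module _ {n : ℕ} where

  MeetsAllPairs : Subset n → Subset n → Set
  MeetsAllPairs S P = ∀ x y → x ∈ P → y ∈ P → x ≢ y → x ∈ S ⊎ y ∈ S

  PairwiseDisjoint : ∀ {m} → (Fin m → Subset n) → Set
  PairwiseDisjoint P = ∀ i j x → x ∈ P i → x ∈ P j → i ≡ j

MeetsAllPairs-tail : ∀ {n s t} {S P : Subset n} → MeetsAllPairs (s ∷ S) (t ∷ P) → MeetsAllPairs S P
MeetsAllPairs-tail meets x y x∈P y∈P x≢y
  with meets (fsuc x) (fsuc y) (there x∈P) (there y∈P) (λ e → x≢y (suc-injective e))
... | inj₁ x∈S = inj₁ (drop-there x∈S)
... | inj₂ y∈S = inj₂ (drop-there y∈S)

∣p∣≤1+∣p∩q∣ : ∀ {n} (P S : Subset n) → MeetsAllPairs S P → ∣ P ∣ ≤ suc ∣ P ∩ S ∣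
∣p∣≤1+∣p∩q∣ []          []          _     = z≤n
∣p∣≤1+∣p∩q∣ (false ∷ P) (_ ∷ S)     meets = ∣p∣≤1+∣p∩q∣ P S (MeetsAllPairs-tail meets)
∣p∣≤1+∣p∩q∣ (true ∷ P)  (true ∷ S)  meets = s≤s (∣p∣≤1+∣p∩q∣ P S (MeetsAllPairs-tail meets))
∣p∣≤1+∣p∩q∣ (true ∷ P)  (false ∷ S) meets = s≤s (p⊆q⇒∣p∣≤∣q∣ P⊆P∩S)
  where
  P⊆P∩S : P ⊆ P ∩ S
  P⊆P∩S {x} x∈P with meets fzero (fsuc x) here (there x∈P) (λ ())
  ... | inj₂ x∈S = x∈p∩q⁺ (x∈P , drop-there x∈S)

∣p∩q∣+∣q∩∁p∣≡∣q∣ : ∀ {n} (P S : Subset n) → ∣ P ∩ S ∣ + ∣ S ∩ ∁ P ∣ ≡ ∣ S ∣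
∣p∩q∣+∣q∩∁p∣≡∣q∣ []          []          = refl
∣p∩q∣+∣q∩∁p∣≡∣q∣ (true ∷ P)  (true ∷ S)  = cong suc (∣p∩q∣+∣q∩∁p∣≡∣q∣ P S)
∣p∩q∣+∣q∩∁p∣≡∣q∣ (true ∷ P)  (false ∷ S) = ∣p∩q∣+∣q∩∁p∣≡∣q∣ P S
∣p∩q∣+∣q∩∁p∣≡∣q∣ (false ∷ P) (true ∷ S)  = trans (+-suc ∣ P ∩ S ∣ ∣ S ∩ ∁ P ∣) (cong suc (∣p∩q∣+∣q∩∁p∣≡∣q∣ P S))
∣p∩q∣+∣q∩∁p∣≡∣q∣ (false ∷ P) (false ∷ S) = ∣p∩q∣+∣q∩∁p∣≡∣q∣ P S

sum-tabulate-mono-≤ : ∀ {m} {f g : Fin m → ℕ} → (∀ i → f i ≤ g i) → sum (tabulate f) ≤ sum (tabulate g)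
sum-tabulate-mono-≤ {zero}  f≤g = z≤n
sum-tabulate-mono-≤ {suc m} f≤g = +-mono-≤ (f≤g fzero) (sum-tabulate-mono-≤ (λ i → f≤g (fsuc i)))

PairwiseDisjoint⇒sum-∣∩∣≤ : ∀ {m n} (P : Fin m → Subset n) → PairwiseDisjoint P → ∀ S →
                            sum (tabulate (λ i → ∣ P i ∩ S ∣)) ≤ ∣ S ∣
PairwiseDisjoint⇒sum-∣∩∣≤ {zero}  P disjoint S = z≤n
PairwiseDisjoint⇒sum-∣∩∣≤ {suc m} P disjoint S = begin
  ∣ P fzero ∩ S ∣ + sum (tabulate (λ i → ∣ P (fsuc i) ∩ S ∣))
    ≤⟨ +-monoʳ-≤ ∣ P fzero ∩ S ∣ (sum-tabulate-mono-≤ (λ i → p⊆q⇒∣p∣≤∣q∣ (outside-P₀ i))) ⟩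
  ∣ P fzero ∩ S ∣ + sum (tabulate (λ i → ∣ P (fsuc i) ∩ S′ ∣))
    ≤⟨ +-monoʳ-≤ ∣ P fzero ∩ S ∣ (PairwiseDisjoint⇒sum-∣∩∣≤ (λ i → P (fsuc i)) disjoint-tail S′) ⟩
  ∣ P fzero ∩ S ∣ + ∣ S′ ∣
    ≡⟨ ∣p∩q∣+∣q∩∁p∣≡∣q∣ (P fzero) S ⟩
  ∣ S ∣ ∎
  where
  open ≤-Reasoning
  S′ = S ∩ ∁ (P fzero)
  disjoint-tail : PairwiseDisjoint (λ i → P (fsuc i))
  disjoint-tail i j x x∈Pi x∈Pj = suc-injective (disjoint (fsuc i) (fsuc j) x x∈Pi x∈Pj)
  outside-P₀ : ∀ i → P (fsuc i) ∩ S ⊆ P (fsuc i) ∩ S′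
  outside-P₀ i {x} x∈ with x∈p∩q⁻ (P (fsuc i)) S x∈
  ... | x∈Pi , x∈S = x∈p∩q⁺ (x∈Pi , x∈p∩q⁺ (x∈S , x∉p⇒x∈∁p (λ x∈P₀ → 0≢1+n (disjoint fzero (fsuc i) x x∈P₀ x∈Pi))))

module _ {n : ℕ} (G : Graph n) where

  Adj-sym : ∀ {a b} → Adj G a b → Adj G b a
  Adj-sym {a} {b} = subst T (Graph.sym G a b)

  simplicial-on-walk⇒source⊎shorter : ∀ {u v p a b} → WalkL G u v p → Consec G a b p → IsSimplicial G a →
    a ≡ u ⊎ ∃[ q ] (WalkL G u v q × length q < length p)
  simplicial-on-walk⇒source⊎shorter single (there ())
  simplicial-on-walk⇒source⊎shorter (step _ _) here _ = inj₁ refl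
  simplicial-on-walk⇒source⊎shorter (step _ single) (there (there ()))
  simplicial-on-walk⇒source⊎shorter {u} (step u~w (step {w = y} {p = rest} w~y walk)) (there ab) a-simp
    with simplicial-on-walk⇒source⊎shorter (step w~y walk) ab a-simp
  ... | inj₂ (q , walk-q , shorter) = inj₂ (u ∷ q , step u~w walk-q , s≤s shorter)
  ... | inj₁ refl with u ≟ y
  ...   | yes refl = inj₂ (rest , walk , s≤s (n≤1+n _))
  ...   | no u≢y   = inj₂ (u ∷ rest , step (a-simp u y (Adj-sym u~w) w~y u≢y) walk , ≤-refl)

  simplicial-on-shortest⇒source : ∀ {u v p a b} → IsShortestPath G u v p → Consec G a b p →
                                  IsSimplicial G a → a ≡ u
  simplicial-on-shortest⇒source (walk , minimal) ab a-simp
    with simplicial-on-walk⇒source⊎shorter walk ab a-simp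
  ... | inj₁ a≡u = a≡u
  ... | inj₂ (q , walk-q , shorter) = ⊥-elim (<-irrefl refl (<-≤-trans shorter (minimal q walk-q)))

  SSPCkU-meets-simplicial-edge : ∀ {k S a b} → IsSSPCkU G k S →
    IsSimplicial G a → IsSimplicial G b → Adj G a b → a ∈ S ⊎ b ∈ S
  SSPCkU-meets-simplicial-edge (_ , shortest , covers) a-simp b-simp a~b with covers _ _ a~b
  ... | u , v , u∈S , d , inj₁ ab with simplicial-on-shortest⇒source (shortest u v u∈S d) ab a-simp
  ...   | refl = inj₁ u∈S
  SSPCkU-meets-simplicial-edge (_ , shortest , covers) a-simp b-simp a~b
      | u , v , u∈S , d , inj₂ ba with simplicial-on-shortest⇒source (shortest u v u∈S d) ba b-simp
  ...   | refl = inj₂ u∈S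

  ∈-simplicialIn⁻ : ∀ {K x} → x ∈ simplicialIn G K → x ∈ K × IsSimplicial G x
  ∈-simplicialIn⁻ {K} {x} x∈ =
    both (x ∈? K) (simplicial? G x) (trans (sym (lookup∘tabulate _ x)) ([]=⇒lookup x∈))
    where
    both : (x∈K? : Dec (x ∈ K)) (simp? : Dec (IsSimplicial G x)) →
           does x∈K? ∧ does simp? ≡ true → x ∈ K × IsSimplicial G x
    both (yes x∈K) (yes x-simp) _ = x∈K , x-simp

  SSPCkU-meets-simplicialIn : ∀ {k S K} → IsSSPCkU G k S → IsClique G K → MeetsAllPairs S (simplicialIn G K)
  SSPCkU-meets-simplicialIn cover clique x y x∈ y∈ x≢y
    with ∈-simplicialIn⁻ x∈ | ∈-simplicialIn⁻ y∈
  ... | x∈K , x-simp | y∈K , y-simp = SSPCkU-meets-simplicial-edge cover x-simp y-simp (clique x y x∈K y∈K x≢y)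

  private
    across-cliques-adjacent : ∀ {A B v x y} → IsClique G A → IsClique G B → v ∈ A → v ∈ B → IsSimplicial G v →
                              x ∈ A → y ∈ B → x ≢ y → Adj G x y
    across-cliques-adjacent {v = v} {x} {y} cA cB v∈A v∈B v-simp x∈A y∈B x≢y with x ≟ v | y ≟ v
    ... | yes refl | _        = cB x y v∈B y∈B x≢y
    ... | no x≢v   | yes refl = cA x y x∈A v∈A x≢y
    ... | no x≢v   | no y≢v   = v-simp x y (cA v x v∈A x∈A (x≢v ∘ sym)) (cB v y v∈B y∈B (y≢v ∘ sym)) x≢y

  clique-∪ : ∀ {A B v} → IsClique G A → IsClique G B → v ∈ A → v ∈ B → IsSimplicial G v → IsClique G (A ∪ B)
  clique-∪ {A} {B} cA cB v∈A v∈B v-simp x y x∈ y∈ x≢y with x∈p∪q⁻ A B x∈ | x∈p∪q⁻ A B y∈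
  ... | inj₁ x∈A | inj₁ y∈A = cA x y x∈A y∈A x≢y
  ... | inj₂ x∈B | inj₂ y∈B = cB x y x∈B y∈B x≢y
  ... | inj₁ x∈A | inj₂ y∈B = across-cliques-adjacent cA cB v∈A v∈B v-simp x∈A y∈B x≢y
  ... | inj₂ x∈B | inj₁ y∈A = Adj-sym (across-cliques-adjacent cA cB v∈A v∈B v-simp y∈A x∈B (x≢y ∘ sym))

  maximal-clique-⊇-clique-through-simplicial : ∀ {A B v} → IsMaximalClique G A → IsClique G B →
                                               v ∈ A → v ∈ B → IsSimplicial G v → B ⊆ A
  maximal-clique-⊇-clique-through-simplicial {A} {B} (cA , maximal) cB v∈A v∈B v-simp x∈B =
    maximal (A ∪ B) (clique-∪ cA cB v∈A v∈B v-simp) (λ x∈A → x∈p∪q⁺ (inj₁ x∈A)) (x∈p∪q⁺ (inj₂ x∈B))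

  simplicial-in-unique-maximal-clique : ∀ {A B v} → IsMaximalClique G A → IsMaximalClique G B →
                                        v ∈ A → v ∈ B → IsSimplicial G v → A ≡ B
  simplicial-in-unique-maximal-clique mA mB v∈A v∈B v-simp =
    ⊆-antisym (maximal-clique-⊇-clique-through-simplicial mB (proj₁ mA) v∈B v∈A v-simp)
              (maximal-clique-⊇-clique-through-simplicial mA (proj₁ mB) v∈A v∈B v-simp)

mainTheorem7 : ∀ {n : ℕ} (G : Graph n) (k : ℕ) → 1 ≤ k →
    ∀ (m : ℕ) (K : Fin m → Subset n) →
    (∀ i j → K i ≡ K j → i ≡ j) →
    (∀ i → IsMaximalClique G (K i)) →
    (∀ i → 2 ≤ numSimplicialIn G (K i)) →
    ∀ (S : Subset n) → IsSSPCkU G k S →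
    sum (tabulate (λ i → numSimplicialIn G (K i) ∸ 1)) ≤ ∣ S ∣
mainTheorem7 G k _ m K K-injective K-maximal _ S cover = begin
  sum (tabulate (λ i → ∣ Simp i ∣ ∸ 1)) ≤⟨ sum-tabulate-mono-≤ all-but-one-in-S ⟩
  sum (tabulate (λ i → ∣ Simp i ∩ S ∣)) ≤⟨ PairwiseDisjoint⇒sum-∣∩∣≤ Simp disjoint S ⟩
  ∣ S ∣                                 ∎
  where
  open ≤-Reasoning
  Simp = λ i → simplicialIn G (K i)
  all-but-one-in-S : ∀ i → ∣ Simp i ∣ ∸ 1 ≤ ∣ Simp i ∩ S ∣
  all-but-one-in-S i = ∸-monoˡ-≤ 1 (∣p∣≤1+∣p∩q∣ (Simp i) S
                         (SSPCkU-meets-simplicialIn G cover (proj₁ (K-maximal i))))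
  disjoint : PairwiseDisjoint Simp
  disjoint i j x x∈i x∈j with ∈-simplicialIn⁻ G x∈i | ∈-simplicialIn⁻ G x∈j
  ... | x∈Ki , x-simp | x∈Kj , _ =
    K-injective i j (simplicial-in-unique-maximal-clique G (K-maximal i) (K-maximal j) x∈Ki x∈Kj x-simp)
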